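{- Let $\mathcal{O}\subset T([n])$ be a nonempty finite order ideal, and let $m_i=\max\{\alpha_i: x^\alpha\in\mathcal{O}\}$ for $i\in[n]$. Let $\emptyset\ne S\subseteq[n]$, let $\alpha\in\mathbb{N}^n$ with $\alpha_i>m_i$ for all $i\in S$, and let $\beta\in\mathbb{N}^n$ with $\beta_i=0$ for $i\notin S$. Then \[\mathrm{ind}_{\mathcal{O}}(x^{\alpha+\beta})=\mathrm{ind}_{\mathcal{O}}(x^\alpha)+|\beta|.\]
   Context: $T([n])=\{x^\alpha:\alpha\in\mathbb{N}^n\}$, $T([n])_k$ the power products of degree $k$, $|\beta|=\sum_i\beta_i$. An order ideal is a set of power products closed under division. For an order ideal $\mathcal{O}$: $\partial\mathcal{O}=(T([n])_1\mathcal{O})\setminus\mathcal{O}$, $\overline{\partial\mathcal{O}}=\partial\mathcal{O}\cup\mathcal{O}$, $\overline{\partial^0\mathcal{O}}=\mathcal{O}$, $\partial^k\mathcal{O}=\partial(\overline{\partial^{k-1}\mathcal{O}})$, $\overline{\partial^k\mathcal{O}}=\partial^k\mathcal{O}\cup\overline{\partial^{k-1}\mathcal{O}}$; $\mathrm{ind}_{\mathcal{O}}(t)$ is the least $k$ with $t\in\overline{\partial^k\mathcal{O}}$. The point $(m_1,\dots,m_n)$ is the extreme corner of the bounding box of $\mathcal{O}$. -}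

module Defs where

open import Data.Nat using (ℕ; zero; suc; _+_; _≤_; _<_; _⊔_)
open import Data.Fin using (Fin; _≟_)
open import Data.Vec using (Vec; lookup; tabulate; zipWith; sum)
open import Data.List using (List; foldr)
open import Data.List.Membership.Propositional using (_∈_)
open import Data.Bool using (if_then_else_)
open import Relation.Nullary.Decidable using (⌊_⌋)
open import Data.Product using (_×_)

-- A power product x^α in T([n]) is represented by its exponent vector α : Vec ℕ n.
PP : ℕ → Set
PP n = Vec ℕ n

_∣ₚ_ : ∀ {n} → PP n → PP n → Set
s ∣ₚ t = ∀ i → lookup s i ≤ lookup t i

_·_ : ∀ {n} → PP n → PP n → PP n
_·_ = zipWith _+_

var : ∀ {n} → Fin n → PP n
var i = tabulate (λ j → if ⌊ i ≟ j ⌋ then 1 else 0)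

deg : ∀ {n} → PP n → ℕ
deg = sum

IsOrderIdeal : ∀ {n} → List (PP n) → Set
IsOrderIdeal O = ∀ {t} → t ∈ O → ∀ s → s ∣ₚ t → s ∈ O

m : ∀ {n} → List (PP n) → Fin n → ℕ
m O i = foldr (λ γ acc → lookup γ i ⊔ acc) 0 O

-- InBar O k t  :  t ∈ closure^k(O), following the recursive definition
--   closure^0 O = O,  closure^(k+1) O = ∂(closure^k O) ∪ closure^k O
--                                     = T_1 · closure^k O ∪ closure^k O.
data InBar {n} (O : List (PP n)) : ℕ → PP n → Set where
  base : ∀ {t} → t ∈ O → InBar O 0 t
  keep : ∀ {k t} → InBar O k t → InBar O (suc k) t
  mult : ∀ {k t} (i : Fin n) → InBar O k t → InBar O (suc k) (var i · t)

IsInd : ∀ {n} → List (PP n) → PP n → ℕ → Set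
IsInd O t k = InBar O k t × (∀ j → InBar O j t → k ≤ j)

module Submission where

-- Write ⟨k⟩ for the k-th closure  ∂̄ᵏ(O).  Two facts about the
-- closures carry the whole argument:
--   (reach)     if t ∈ ⟨k⟩ then δ·t ∈ ⟨k + |δ|⟩, since δ·t is obtained from t
--               by |δ| multiplications by single variables;
--   (generator) if t ∈ ⟨j⟩ then some o ∈ O divides t and |t| ≤ j + |o|, since
--               every closure step raises the degree by at most one.
-- Upper bound: α ∈ ⟨k⟩ gives α·β ∈ ⟨k + |β|⟩ by (reach).
-- Lower bound: if α·β ∈ ⟨j⟩, take o from (generator).  Such an o divides α:
-- on S because o_i ≤ m_i < α_i, off S because β_i = 0.  Writing α = δ·o,
-- (reach) puts α in ⟨|δ|⟩, so minimality of k gives k + |o| ≤ |α|, whence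
-- k + |β| + |o| ≤ |α·β| ≤ j + |o|, i.e. k + |β| ≤ j.

open import Defs
open import Data.Nat using (ℕ; zero; suc; _+_; _∸_; _≤_; _<_; s≤s)
open import Data.Nat.Properties
  using (+-comm; +-identityʳ; +-commutativeSemigroup; ≤-refl; ≤-trans;
         <⇒≤; m≤n⇒m≤1+n; m≤n+m; m≤m⊔n; m≤n⊔m; m∸n+n≡m; +-monoˡ-≤; +-cancelʳ-≤;
         module ≤-Reasoning)
open import Algebra.Properties.CommutativeSemigroup +-commutativeSemigroup using (interchange; xy∙z≈xz∙y)
open import Data.Fin using (Fin; zero; suc; _≟_)
open import Data.Fin.Subset using (Subset; Nonempty; _∈_; _∉_)
open import Data.Fin.Subset.Properties using (_∈?_)
open import Data.Vec using ([]; _∷_; lookup; tabulate; zipWith; sum)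
open import Data.Vec.Properties using (lookup-zipWith; zipWith-comm; tabulate-cong)
open import Data.List using (List; []; _∷_; _++_; length; replicate; map)
open import Data.List.Properties using (length-++; length-map; length-replicate)
import Data.List.Membership.Propositional as List
open import Data.List.Relation.Unary.Any using (here; there)
open import Data.Bool using (if_then_else_)
open import Data.Product using (Σ-syntax; _×_; _,_)
open import Relation.Nullary using (yes; no)
open import Relation.Nullary.Decidable using (⌊_⌋)
open import Relation.Binary.PropositionalEquality
  using (_≡_; _≢_; refl; sym; trans; cong; cong₂; subst; subst₂; module ≡-Reasoning)

lookup-· : ∀ {n} (a b : PP n) i → lookup (a · b) i ≡ lookup a i + lookup b i
lookup-· a b i = lookup-zipWith _+_ i a b

·-comm : ∀ {n} (a b : PP n) → a · b ≡ b · a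
·-comm = zipWith-comm +-comm

deg-· : ∀ {n} (a b : PP n) → deg (a · b) ≡ deg a + deg b
deg-· []       []       = refl
deg-· (x ∷ a) (y ∷ b) = trans (cong (x + y +_) (deg-· a b)) (interchange x y (sum a) (sum b))

∣ₚ-· : ∀ {n} (a b : PP n) → b ∣ₚ (a · b)
∣ₚ-· a b i = subst (lookup b i ≤_) (sym (lookup-· a b i)) (m≤n+m (lookup b i) (lookup a i))

_÷_ : ∀ {n} → PP n → PP n → PP n
_÷_ = zipWith _∸_

÷-· : ∀ {n} (a o : PP n) → o ∣ₚ a → (a ÷ o) · o ≡ a
÷-· []      []      _   = refl
÷-· (x ∷ a) (y ∷ o) o∣a = cong₂ _∷_ (m∸n+n≡m (o∣a zero)) (÷-· a o (λ i → o∣a (suc i)))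

private
  zeros-· : ∀ {n} (v : PP n) → tabulate (λ (_ : Fin n) → 0) · v ≡ v
  zeros-· []      = refl
  zeros-· (x ∷ v) = cong (x ∷_) (zeros-· v)

  suc-≟ : ∀ {n} (i j : Fin n) → ⌊ suc i ≟ suc j ⌋ ≡ ⌊ i ≟ j ⌋
  suc-≟ i j with i ≟ j
  ... | yes _ = refl
  ... | no  _ = refl

var-suc : ∀ {n} (i : Fin n) → var {suc n} (suc i) ≡ 0 ∷ var i
var-suc i = cong (0 ∷_) (tabulate-cong (λ j → cong (λ b → if b then 1 else 0) (suc-≟ i j)))

var-zero-· : ∀ {n} y (v : PP n) → var zero · (y ∷ v) ≡ suc y ∷ v
var-zero-· y v = cong (suc y ∷_) (zeros-· v)

var-suc-· : ∀ {n} (i : Fin n) y (v : PP n) → var (suc i) · (y ∷ v) ≡ y ∷ (var i · v)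
var-suc-· i y v = cong (_· (y ∷ v)) (var-suc i)

deg-var : ∀ {n} (i : Fin n) → deg (var i) ≡ 1
deg-var {suc n} zero    = cong suc (zeros n)
  where
  zeros : ∀ n → sum (tabulate (λ (_ : Fin n) → 0)) ≡ 0
  zeros zero    = refl
  zeros (suc n) = zeros n
deg-var         (suc i) = trans (cong deg (var-suc i)) (deg-var i)

_⋆_ : ∀ {n} → List (Fin n) → PP n → PP n
[]      ⋆ t = t
(i ∷ w) ⋆ t = var i · (w ⋆ t)

⋆-++ : ∀ {n} (u w : List (Fin n)) t → (u ++ w) ⋆ t ≡ u ⋆ (w ⋆ t)
⋆-++ []      w t = refl
⋆-++ (i ∷ u) w t = cong (var i ·_) (⋆-++ u w t)

map-suc-⋆ : ∀ {n} (w : List (Fin n)) y (v : PP n) → map suc w ⋆ (y ∷ v) ≡ y ∷ (w ⋆ v)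
map-suc-⋆ []      y v = refl
map-suc-⋆ (i ∷ w) y v = trans (cong (var (suc i) ·_) (map-suc-⋆ w y v)) (var-suc-· i y (w ⋆ v))

replicate-zero-⋆ : ∀ {n} x y (v : PP n) → replicate x zero ⋆ (y ∷ v) ≡ (x + y) ∷ v
replicate-zero-⋆ zero    y v = refl
replicate-zero-⋆ (suc x) y v =
  trans (cong (var zero ·_) (replicate-zero-⋆ x y v)) (var-zero-· (x + y) v)

word : ∀ {n} → PP n → List (Fin n)
word []      = []
word (x ∷ δ) = replicate x zero ++ map suc (word δ)

length-word : ∀ {n} (δ : PP n) → length (word δ) ≡ deg δ
length-word []      = refl
length-word (x ∷ δ) = begin
  length (replicate x zero ++ map suc (word δ))          ≡⟨ length-++ (replicate x zero) ⟩
  length (replicate x zero) + length (map suc (word δ))  ≡⟨ cong₂ _+_ (length-replicate x)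
                                                                 (length-map suc (word δ)) ⟩
  x + length (word δ)                                     ≡⟨ cong (x +_) (length-word δ) ⟩
  x + deg δ                                               ∎
  where open ≡-Reasoning

word-⋆ : ∀ {n} (δ t : PP n) → word δ ⋆ t ≡ δ · t
word-⋆ []      []      = refl
word-⋆ (x ∷ δ) (y ∷ t) = begin
  (replicate x zero ++ map suc (word δ)) ⋆ (y ∷ t)  ≡⟨ ⋆-++ (replicate x zero) _ (y ∷ t) ⟩
  replicate x zero ⋆ (map suc (word δ) ⋆ (y ∷ t))   ≡⟨ cong (replicate x zero ⋆_) (map-suc-⋆ (word δ) y t) ⟩
  replicate x zero ⋆ (y ∷ (word δ ⋆ t))             ≡⟨ replicate-zero-⋆ x y (word δ ⋆ t) ⟩
  (x + y) ∷ (word δ ⋆ t)                            ≡⟨ cong ((x + y) ∷_) (word-⋆ δ t) ⟩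
  (x + y) ∷ (δ · t)                                 ∎
  where open ≡-Reasoning

InBar-⋆ : ∀ {n} {O : List (PP n)} {k t} (w : List (Fin n)) →
          InBar O k t → InBar O (length w + k) (w ⋆ t)
InBar-⋆ []      t∈ = t∈
InBar-⋆ (i ∷ w) t∈ = mult i (InBar-⋆ w t∈)

InBar-· : ∀ {n} {O : List (PP n)} {k t} (δ : PP n) →
          InBar O k t → InBar O (deg δ + k) (δ · t)
InBar-· {O = O} {k} {t} δ t∈ =
  subst₂ (InBar O) (cong (_+ k) (length-word δ)) (word-⋆ δ t) (InBar-⋆ (word δ) t∈)

generator : ∀ {n} {O : List (PP n)} {j t} → InBar O j t →
            Σ[ o ∈ PP n ] (o List.∈ O) × (o ∣ₚ t) × (deg t ≤ j + deg o)
generator (base {t} t∈O) = t , t∈O , (λ _ → ≤-refl) , ≤-refl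
generator (keep t∈) with generator t∈
... | o , o∈O , o∣t , bound = o , o∈O , o∣t , m≤n⇒m≤1+n bound
generator (mult {t = t} i t∈) with generator t∈
... | o , o∈O , o∣t , bound =
  o , o∈O , (λ j → ≤-trans (o∣t j) (∣ₚ-· (var i) t j)) ,
  subst (_≤ _) (sym (trans (deg-· (var i) t) (cong (_+ deg t) (deg-var i)))) (s≤s bound)

m-bound : ∀ {n} (O : List (PP n)) {o} → o List.∈ O → ∀ i → lookup o i ≤ m O i
m-bound (γ ∷ O) (here refl) i = m≤m⊔n (lookup γ i) _
m-bound (γ ∷ O) (there o∈O) i = ≤-trans (m-bound O o∈O i) (m≤n⊔m (lookup γ i) _)

ind-bound : ∀ {n} {O : List (PP n)} {α o k} → IsInd O α k →
            o List.∈ O → o ∣ₚ α → k + deg o ≤ deg α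
ind-bound {O = O} {α} {o} {k} (_ , minimal) o∈O o∣α =
  subst (k + deg o ≤_) deg-α (+-monoˡ-≤ (deg o) k≤|δ|)
  where
  δ = α ÷ o
  α∈ : InBar O (deg δ + 0) α
  α∈ = subst (InBar O _) (÷-· α o o∣α) (InBar-· δ (base o∈O))
  k≤|δ| : k ≤ deg δ
  k≤|δ| = subst (k ≤_) (+-identityʳ (deg δ)) (minimal _ α∈)
  deg-α : deg δ + deg o ≡ deg α
  deg-α = trans (sym (deg-· δ o)) (cong deg (÷-· α o o∣α))

mainTheorem6 : ∀ (n : ℕ) (O : List (PP n)) → O ≢ [] → IsOrderIdeal O →
               (S : Subset n) → Nonempty S →
               (α : PP n) → (∀ i → i ∈ S → m O i < lookup α i) →
               (β : PP n) → (∀ i → i ∉ S → lookup β i ≡ 0) →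
               ∀ k → IsInd O α k → IsInd O (α · β) (k + deg β)
mainTheorem6 n O _ _ S _ α α>m β β-off-S k ind-α@(α∈ , _) = upper , lower
  where
  upper : InBar O (k + deg β) (α · β)
  upper = subst₂ (InBar O) (+-comm (deg β) k) (·-comm β α) (InBar-· β α∈)

  divides-α : ∀ {o} → o List.∈ O → o ∣ₚ (α · β) → o ∣ₚ α
  divides-α o∈O o∣αβ i with i ∈? S
  ... | yes i∈S = ≤-trans (m-bound O o∈O i) (<⇒≤ (α>m i i∈S))
  ... | no  i∉S = subst (_ ≤_) (trans (lookup-· α β i)
                    (trans (cong (lookup α i +_) (β-off-S i i∉S)) (+-identityʳ _))) (o∣αβ i)

  lower : ∀ j → InBar O j (α · β) → k + deg β ≤ j
  lower j αβ∈ with generator αβ∈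
  ... | o , o∈O , o∣αβ , bound = +-cancelʳ-≤ (deg o) (k + deg β) j (begin
    k + deg β + deg o    ≡⟨ xy∙z≈xz∙y k (deg β) (deg o) ⟩
    k + deg o + deg β    ≤⟨ +-monoˡ-≤ (deg β) (ind-bound ind-α o∈O (divides-α o∈O o∣αβ)) ⟩
    deg α + deg β        ≡⟨ deg-· α β ⟨
    deg (α · β)          ≤⟨ bound ⟩
    j + deg o            ∎)
    where open ≤-Reasoning
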